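{- Let $n\geq 2$, $K\leq\mathrm{Aut}(Q_n)$ and $\Pi:=(Q_n)_K$. If $d_K\geq 7$, then every connected component of the distance $2$ graph $\Pi_2$ is locally $T_n$.
   Context: The $n$-cube $Q_n$ has vertex set $\mathbb{F}_2^n$, two vectors adjacent iff their Hamming distance is $1$; $\mathrm{Aut}(Q_n)=\mathbb{F}_2^n: S_n$. For $K\leq\mathrm{Aut}(Q_n)$, $d_K:=\min\{d_{Q_n}(x,x^k): x\in\mathbb{F}_2^n,\ 1\neq k\in K\}$ if $K\neq 1$ and $d_K:=\infty$ if $K=1$. The normal quotient $(Q_n)_K$ is the simple graph whose vertices are the $K$-orbits, distinct orbits adjacent iff some vertex of one is adjacent in $Q_n$ to some vertex of the other. The distance $2$ graph $\Pi_2$ has vertex set $V\Pi$, two vertices adjacent iff at distance exactly $2$ in $\Pi$. The triangular graph $T_n$ has vertex set the $2$-subsets of $\{1,\dots,n\}$, two adjacent iff they meet in exactly one point; a graph is locally $T_n$ if the subgraph induced on each vertex neighbourhood is isomorphic to $T_n$. -}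

module Defs where

open import Data.Nat using (ℕ; zero; suc; _+_; _≤_)
open import Data.Bool using (Bool; true; false; _xor_)
open import Data.Fin using (Fin; _<_)
import Data.Fin as F
open import Data.Fin.Permutation using (Permutation′; _⟨$⟩ʳ_; _⟨$⟩ˡ_; _∘ₚ_; flip)
import Data.Fin.Permutation as P
open import Data.Product using (Σ; ∃; _×_; _,_; proj₁; proj₂)
open import Data.Sum using (_⊎_)
open import Relation.Binary.PropositionalEquality using (_≡_)
open import Relation.Nullary using (¬_)
open import Function.Bundles using (_⇔_)

V : ℕ → Set
V n = Fin n → Bool

-- Hamming distance (= graph distance in Q_n)
hamming : ∀ {n} → V n → V n → ℕ
hamming {zero}  x y = 0
hamming {suc n} x y =
  (if x F.zero xor y F.zero then 1 else 0) + hamming (λ i → x (F.suc i)) (λ i → y (F.suc i))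
  where open import Data.Bool using (if_then_else_)

QAdj : ∀ {n} → V n → V n → Set
QAdj x y = hamming x y ≡ 1

_≐_ : ∀ {n} → V n → V n → Set
x ≐ y = ∀ i → x i ≡ y i

-- Aut(Q_n) = F_2^n : S_n ; an element is a pair (translation v, permutation σ)
Aut : ℕ → Set
Aut n = V n × Permutation′ n

act : ∀ {n} → Aut n → V n → V n
act (v , σ) x i = x (σ ⟨$⟩ʳ i) xor v i

-- group operations, chosen so that act (mul a b) = act a ∘ act b
idA : ∀ {n} → Aut n
idA = (λ _ → false) , P.id

mul : ∀ {n} → Aut n → Aut n → Aut n
mul (v , σ) (w , τ) = (λ i → w (σ ⟨$⟩ʳ i) xor v i) , (σ ∘ₚ τ)

inv : ∀ {n} → Aut n → Aut n
inv (v , σ) = (λ j → v (σ ⟨$⟩ˡ j)) , flip σ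

_≈A_ : ∀ {n} → Aut n → Aut n → Set
(v , σ) ≈A (w , τ) = (∀ i → v i ≡ w i) × (∀ i → σ ⟨$⟩ʳ i ≡ τ ⟨$⟩ʳ i)

record IsSubgroup {n} (K : Aut n → Set) : Set where
  field
    resp   : ∀ {a b} → a ≈A b → K a → K b
    has-id : K idA
    closed : ∀ {a b} → K a → K b → K (mul a b)
    inverse : ∀ {a} → K a → K (inv a)

-- d_K ≥ m  (vacuous when K = 1, matching d_K = ∞)
dK≥ : ∀ {n} → (Aut n → Set) → ℕ → Set
dK≥ {n} K m = ∀ (k : Aut n) → K k → ¬ (k ≈A idA) → ∀ (x : V n) → m ≤ hamming x (act k x)

SameOrbit : ∀ {n} → (Aut n → Set) → V n → V n → Set
SameOrbit {n} K x y = Σ (Aut n) λ k → K k × (act k x ≐ y)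

-- adjacency in the normal quotient Π = (Q_n)_K, on representatives of orbits
PiAdj : ∀ {n} → (Aut n → Set) → V n → V n → Set
PiAdj {n} K x y =
  ¬ SameOrbit K x y ×
  Σ (V n) λ x′ → Σ (V n) λ y′ → SameOrbit K x x′ × SameOrbit K y y′ × QAdj x′ y′

Pi2Adj : ∀ {n} → (Aut n → Set) → V n → V n → Set
Pi2Adj {n} K x y =
  ¬ SameOrbit K x y × ¬ PiAdj K x y × Σ (V n) λ z → PiAdj K x z × PiAdj K z y

-- vertices of the triangular graph T_n: 2-subsets {i,j} with i < j
Pair : ℕ → Set
Pair n = Σ (Fin n × Fin n) λ p → proj₁ p < proj₂ p

SamePair : ∀ {n} → Pair n → Pair n → Set
SamePair ((i , j) , _) ((k , l) , _) = i ≡ k × j ≡ l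

TAdj : ∀ {n} → Pair n → Pair n → Set
TAdj ((i , j) , _) ((k , l) , _) =
  ((i ≡ k) ⊎ (i ≡ l) ⊎ (j ≡ k) ⊎ (j ≡ l)) × ¬ (i ≡ k × j ≡ l)

-- The subgraph of Π_2 induced on the neighbourhood of (the orbit of) x is
-- isomorphic to T_n: f is a bijection from V(T_n) onto the set of
-- Π_2-neighbour orbits of x, and it preserves and reflects adjacency.
LocallyTnAt : ∀ {n} → (Aut n → Set) → V n → Set
LocallyTnAt {n} K x =
  Σ (Pair n → V n) λ f →
    (∀ e → Pi2Adj K x (f e)) ×
    (∀ e e′ → SameOrbit K (f e) (f e′) → SamePair e e′) ×
    (∀ y → Pi2Adj K x y → Σ (Pair n) λ e → SameOrbit K (f e) y) ×
    (∀ e e′ → Pi2Adj K (f e) (f e′) ⇔ TAdj e e′)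

-- every connected component of Π_2 is locally T_n; since the neighbourhood
-- of a vertex lies in its component, this is: every vertex is locally T_n
ComponentsLocallyTn : ∀ {n} → (Aut n → Set) → Set
ComponentsLocallyTn {n} K = ∀ (x : V n) → LocallyTnAt K x

-- Since K acts by isometries, any two K-orbits have representatives realising
-- the distance between the orbits with one representative prescribed; so the
-- Π₂-neighbours of the orbit of x are the orbits of the vertices at Hamming
-- distance 2 from x, namely x + e_i + e_j for the 2-subsets {i, j}.  Two such
-- vertices are at distance 0, 2 or 4 according as their 2-subsets are equal,
-- meet in one point, or are disjoint.  Every distance in sight is at most 6,
-- and d_K ≥ 7 forces distinct vertices of one orbit to be at distance ≥ 7; hence
-- orbit representatives are unique in this range and Π₂ is locally T_n.
module Submission where

open import Defs
open import Data.Bool using (Bool; true; false; not; _xor_; if_then_else_)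
open import Data.Bool.Properties using (¬-not; xor-comm; xor-assoc; xor-same; xor-identityʳ)
  renaming (_≟_ to _≟ᵇ_)
open import Data.Fin using (Fin; zero; suc; _≟_)
open import Data.Fin.Permutation using (_⟨$⟩ʳ_; _⟨$⟩ˡ_; inverseʳ)
open import Data.Fin.Properties using (<⇒≢; <-asym; <-trans)
open import Data.Nat using (ℕ; zero; suc; _+_; _≤_; z≤n; s≤s; s<s)
open import Data.Nat.Properties
  using (+-suc; +-mono-≤; ≤-trans; ≤-reflexive; ≤⇒≯; suc-injective;
         +-0-monoid; +-0-commutativeMonoid; +-commutativeSemigroup)
open import Data.Product using (Σ; _×_; _,_)
open import Data.Sum using (_⊎_; inj₁; inj₂)
open import Data.Vec.Functional using (tail; updateAt)
open import Data.Vec.Functional.Properties using (updateAt-minimal; updateAt-commutes)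
open import Function using (_∘_; _⟨_⟩_)
open import Function.Bundles using (_⇔_; mk⇔)
open import Function.Construct.Composition using (_⇔-∘_)
open import Relation.Binary.PropositionalEquality
open import Relation.Nullary using (¬_; yes; no; contradiction)
open import Relation.Nullary.Decidable using (_×-dec_; _⊎-dec_; decidable-stable)
open import Algebra.Properties.CommutativeMonoid.Sum +-0-commutativeMonoid using (sum; sum-permute)
open import Algebra.Properties.Monoid.Sum +-0-monoid using (sum-cong-≗)
open import Algebra.Properties.CommutativeSemigroup +-commutativeSemigroup using (interchange)

private
  variable
    n : ℕ

differs : Bool → Bool → ℕ
differs a b = if a xor b then 1 else 0

hamming≡sum : (x y : V n) → hamming x y ≡ sum (λ i → differs (x i) (y i))
hamming≡sum {zero}  x y = refl
hamming≡sum {suc n} x y = cong (differs (x zero) (y zero) +_) (hamming≡sum (tail x) (tail y))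

hamming-cong : {x x′ y y′ : V n} → x ≐ x′ → y ≐ y′ → hamming x y ≡ hamming x′ y′
hamming-cong {zero}  x≐x′ y≐y′ = refl
hamming-cong {suc n} x≐x′ y≐y′ =
  cong₂ _+_ (cong₂ differs (x≐x′ zero) (y≐y′ zero)) (hamming-cong (x≐x′ ∘ suc) (y≐y′ ∘ suc))

hamming-sym : (x y : V n) → hamming x y ≡ hamming y x
hamming-sym {zero}  x y = refl
hamming-sym {suc n} x y =
  cong₂ _+_ (cong (if_then 1 else 0) (xor-comm (x zero) (y zero))) (hamming-sym (tail x) (tail y))

hamming-head-≡ : (x y : V (suc n)) → x zero ≡ y zero → hamming x y ≡ hamming (tail x) (tail y)
hamming-head-≡ x y x₀≡y₀ rewrite x₀≡y₀ | xor-same (y zero) = refl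

hamming-head-≢ : (x y : V (suc n)) → x zero ≢ y zero → hamming x y ≡ suc (hamming (tail x) (tail y))
hamming-head-≢ x y x₀≢y₀ rewrite ¬-not x₀≢y₀ = cong (_+ hamming (tail x) (tail y)) (differs-not (y zero))
  where
  differs-not : ∀ a → differs (not a) a ≡ 1
  differs-not false = refl
  differs-not true  = refl

hamming-self : (x : V n) → hamming x x ≡ 0
hamming-self {zero}  x = refl
hamming-self {suc n} x = hamming-head-≡ x x refl ⟨ trans ⟩ hamming-self (tail x)

≐⇒hamming≡0 : {x y : V n} → x ≐ y → hamming x y ≡ 0
≐⇒hamming≡0 {x = x} x≐y = hamming-cong (λ _ → refl) (λ i → sym (x≐y i)) ⟨ trans ⟩ hamming-self x

hamming≡0⇒≐ : (x y : V n) → hamming x y ≡ 0 → x ≐ y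
hamming≡0⇒≐ {suc n} x y h i with x zero ≟ᵇ y zero
hamming≡0⇒≐ {suc n} x y h zero    | yes x₀≡y₀ = x₀≡y₀
hamming≡0⇒≐ {suc n} x y h (suc i) | yes x₀≡y₀ =
  hamming≡0⇒≐ (tail x) (tail y) (sym (hamming-head-≡ x y x₀≡y₀) ⟨ trans ⟩ h) i
... | no x₀≢y₀ with () ← sym (hamming-head-≢ x y x₀≢y₀) ⟨ trans ⟩ h

hamming-triangle : (x y z : V n) → hamming x z ≤ hamming x y + hamming y z
hamming-triangle {zero}  x y z = z≤n
hamming-triangle {suc n} x y z = ≤-trans
  (+-mono-≤ (differs-triangle (x zero) (y zero) (z zero)) (hamming-triangle (tail x) (tail y) (tail z)))
  (≤-reflexive (interchange (differs (x zero) (y zero)) (differs (y zero) (z zero)) _ _))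
  where
  differs-triangle : ∀ a b c → differs a c ≤ differs a b + differs b c
  differs-triangle false false false = z≤n
  differs-triangle false false true  = s≤s z≤n
  differs-triangle false true  false = z≤n
  differs-triangle false true  true  = s≤s z≤n
  differs-triangle true  false false = s≤s z≤n
  differs-triangle true  false true  = z≤n
  differs-triangle true  true  false = s≤s z≤n
  differs-triangle true  true  true  = z≤n

hamming-triangle≡ : (x y z : V n) {a b : ℕ} →
  hamming x y ≡ a → hamming y z ≡ b → hamming x z ≤ a + b
hamming-triangle≡ x y z refl refl = hamming-triangle x y z

toggle : Fin n → V n → V n
toggle a u = updateAt u a not

toggle₂ : Fin n → Fin n → V n → V n
toggle₂ a b u = toggle a (toggle b u)

toggle₂-comm : (a b : Fin n) (u : V n) → a ≢ b → toggle₂ a b u ≐ toggle₂ b a u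
toggle₂-comm a b u a≢b = updateAt-commutes a b a≢b u

toggle₂-other : (a b c : Fin n) (u : V n) → c ≢ a → c ≢ b → toggle₂ a b u c ≡ u c
toggle₂-other a b c u c≢a c≢b = updateAt-minimal c a _ c≢a ⟨ trans ⟩ updateAt-minimal c b u c≢b

hamming-toggle-both : (a : Fin n) (u w : V n) → hamming (toggle a u) (toggle a w) ≡ hamming u w
hamming-toggle-both zero    u w = cong (_+ hamming (tail u) (tail w)) (differs-not-not (u zero) (w zero))
  where
  differs-not-not : ∀ a b → differs (not a) (not b) ≡ differs a b
  differs-not-not false false = refl
  differs-not-not false true  = refl
  differs-not-not true  false = refl
  differs-not-not true  true  = refl
hamming-toggle-both (suc a) u w = cong (differs (u zero) (w zero) +_) (hamming-toggle-both a (tail u) (tail w))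

hamming-toggleʳ : (a : Fin n) (u w : V n) → u a ≡ w a → hamming u (toggle a w) ≡ suc (hamming u w)
hamming-toggleʳ zero    u w u₀≡w₀ rewrite u₀≡w₀ = cong (_+ hamming (tail u) (tail w)) (differs-flip (w zero))
  where
  differs-flip : ∀ b → differs b (not b) ≡ suc (differs b b)
  differs-flip false = refl
  differs-flip true  = refl
hamming-toggleʳ (suc a) u w uₐ≡wₐ =
  cong (differs (u zero) (w zero) +_) (hamming-toggleʳ a (tail u) (tail w) uₐ≡wₐ)
  ⟨ trans ⟩ +-suc (differs (u zero) (w zero)) _

hamming-toggle : (a : Fin n) (u : V n) → hamming u (toggle a u) ≡ 1
hamming-toggle a u = hamming-toggleʳ a u u refl ⟨ trans ⟩ cong suc (hamming-self u)

hamming-toggle₂ : (a b : Fin n) (u : V n) → a ≢ b → hamming u (toggle₂ a b u) ≡ 2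
hamming-toggle₂ a b u a≢b =
  hamming-toggleʳ a u (toggle b u) (sym (updateAt-minimal a b u a≢b)) ⟨ trans ⟩ cong suc (hamming-toggle b u)

hamming-toggle₂-shared : (a b c : Fin n) (u : V n) → b ≢ c →
  hamming (toggle₂ a b u) (toggle₂ a c u) ≡ 2
hamming-toggle₂-shared a b c u b≢c = begin
  hamming (toggle₂ a b u) (toggle₂ a c u)  ≡⟨ hamming-toggle-both a (toggle b u) (toggle c u) ⟩
  hamming (toggle b u) (toggle c u)        ≡⟨ hamming-toggleʳ c (toggle b u) u (updateAt-minimal c b u (b≢c ∘ sym)) ⟩
  suc (hamming (toggle b u) u)             ≡⟨ cong suc (hamming-sym (toggle b u) u ⟨ trans ⟩ hamming-toggle b u) ⟩
  2                                        ∎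
  where open ≡-Reasoning

hamming-toggle₂-disjoint : (i j k l : Fin n) (u : V n) → i ≢ j →
  k ≢ i → k ≢ j → k ≢ l → l ≢ i → l ≢ j → hamming (toggle₂ i j u) (toggle₂ k l u) ≡ 4
hamming-toggle₂-disjoint i j k l u i≢j k≢i k≢j k≢l l≢i l≢j = begin
  hamming v (toggle k (toggle l u))  ≡⟨ hamming-toggleʳ k v (toggle l u) vₖ≡ ⟩
  suc (hamming v (toggle l u))       ≡⟨ cong suc (hamming-toggleʳ l v u (toggle₂-other i j l u l≢i l≢j)) ⟩
  suc (suc (hamming v u))            ≡⟨ cong (λ d → suc (suc d)) (hamming-sym v u ⟨ trans ⟩ hamming-toggle₂ i j u i≢j) ⟩
  4                                  ∎
  where
  open ≡-Reasoning
  v = toggle₂ i j u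
  vₖ≡ : v k ≡ toggle l u k
  vₖ≡ = toggle₂-other i j k u k≢i k≢j ⟨ trans ⟩ sym (updateAt-minimal k l u k≢l)

hamming≡1⇒toggle : (u w : V n) → hamming u w ≡ 1 → Σ (Fin n) λ a → w ≐ toggle a u
hamming≡1⇒toggle {suc n} u w h with u zero ≟ᵇ w zero
... | yes u₀≡w₀ =
  let a , w′≐ = hamming≡1⇒toggle (tail u) (tail w) (sym (hamming-head-≡ u w u₀≡w₀) ⟨ trans ⟩ h)
  in suc a , λ { zero → sym u₀≡w₀ ; (suc i) → w′≐ i }
... | no u₀≢w₀ = zero , λ
  { zero → ¬-not (u₀≢w₀ ∘ sym)
  ; (suc i) → sym (hamming≡0⇒≐ (tail u) (tail w) (suc-injective (sym (hamming-head-≢ u w u₀≢w₀) ⟨ trans ⟩ h)) i)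
  }

togglePair : Pair n → V n → V n
togglePair ((i , j) , _) = toggle₂ i j

Disjoint : Pair n → Pair n → Set
Disjoint ((i , j) , _) ((k , l) , _) = i ≢ k × i ≢ l × j ≢ k × j ≢ l

pair-trichotomy : (e e′ : Pair n) → SamePair e e′ ⊎ TAdj e e′ ⊎ Disjoint e e′
pair-trichotomy ((i , j) , _) ((k , l) , _)
  with (i ≟ k) ×-dec (j ≟ l) | (i ≟ k) ⊎-dec (i ≟ l) ⊎-dec (j ≟ k) ⊎-dec (j ≟ l)
... | yes same | _          = inj₁ same
... | no ¬same | yes meet   = inj₂ (inj₁ (meet , ¬same))
... | no _     | no ¬meet   =
  inj₂ (inj₂ (¬meet ∘ inj₁ , ¬meet ∘ inj₂ ∘ inj₁ , ¬meet ∘ inj₂ ∘ inj₂ ∘ inj₁ , ¬meet ∘ inj₂ ∘ inj₂ ∘ inj₂))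

hamming≡2⇒togglePair : (u w : V n) → hamming u w ≡ 2 → Σ (Pair n) λ e → w ≐ togglePair e u
hamming≡2⇒togglePair {suc n} u w h with u zero ≟ᵇ w zero
... | yes u₀≡w₀ =
  let ((i , j) , i<j) , w′≐ = hamming≡2⇒togglePair (tail u) (tail w) (sym (hamming-head-≡ u w u₀≡w₀) ⟨ trans ⟩ h)
  in ((suc i , suc j) , s<s i<j) , λ { zero → sym u₀≡w₀ ; (suc i) → w′≐ i }
... | no u₀≢w₀ =
  let a , w′≐ = hamming≡1⇒toggle (tail u) (tail w) (suc-injective (sym (hamming-head-≢ u w u₀≢w₀) ⟨ trans ⟩ h))
  in ((zero , suc a) , s≤s z≤n) , λ { zero → ¬-not (u₀≢w₀ ∘ sym) ; (suc i) → w′≐ i }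

hamming-togglePair : (e : Pair n) (x : V n) → hamming x (togglePair e x) ≡ 2
hamming-togglePair ((i , j) , i<j) x = hamming-toggle₂ i j x (<⇒≢ i<j)

hamming-togglePair≤4 : (e e′ : Pair n) (x : V n) → hamming (togglePair e x) (togglePair e′ x) ≤ 4
hamming-togglePair≤4 e e′ x =
  hamming-triangle≡ (togglePair e x) x (togglePair e′ x)
    (hamming-sym (togglePair e x) x ⟨ trans ⟩ hamming-togglePair e x) (hamming-togglePair e′ x)

hamming-togglePair-same : (e e′ : Pair n) (x : V n) → SamePair e e′ →
  hamming (togglePair e x) (togglePair e′ x) ≡ 0
hamming-togglePair-same ((i , j) , _) ((.i , .j) , _) x (refl , refl) = hamming-self (toggle₂ i j x)

-- Pairs are stored in increasing order; commuting the toggles brings the shared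
-- point to the front.
hamming-togglePair-adjacent : (e e′ : Pair n) (x : V n) → TAdj e e′ →
  hamming (togglePair e x) (togglePair e′ x) ≡ 2
hamming-togglePair-adjacent ((i , j) , i<j) ((.i , l) , _) x (inj₁ refl , ¬same) =
  hamming-toggle₂-shared i j l x (¬same ∘ (refl ,_))
hamming-togglePair-adjacent ((i , j) , i<j) ((k , .i) , k<i) x (inj₂ (inj₁ refl) , _) =
  hamming-cong (λ _ → refl) (toggle₂-comm k i x (<⇒≢ k<i))
  ⟨ trans ⟩ hamming-toggle₂-shared i j k x λ { refl → <-asym i<j k<i }
hamming-togglePair-adjacent ((i , j) , i<j) ((.j , l) , j<l) x (inj₂ (inj₂ (inj₁ refl)) , _) =
  hamming-cong (toggle₂-comm i j x (<⇒≢ i<j)) (λ _ → refl)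
  ⟨ trans ⟩ hamming-toggle₂-shared j i l x (<⇒≢ (<-trans i<j j<l))
hamming-togglePair-adjacent ((i , j) , i<j) ((k , .j) , k<j) x (inj₂ (inj₂ (inj₂ refl)) , ¬same) =
  hamming-cong (toggle₂-comm i j x (<⇒≢ i<j)) (toggle₂-comm k j x (<⇒≢ k<j))
  ⟨ trans ⟩ hamming-toggle₂-shared j i k x (¬same ∘ (_, refl))

hamming-togglePair-disjoint : (e e′ : Pair n) (x : V n) → Disjoint e e′ →
  hamming (togglePair e x) (togglePair e′ x) ≡ 4
hamming-togglePair-disjoint ((i , j) , i<j) ((k , l) , k<l) x (i≢k , i≢l , j≢k , j≢l) =
  hamming-toggle₂-disjoint i j k l x (<⇒≢ i<j) (i≢k ∘ sym) (j≢k ∘ sym) (<⇒≢ k<l) (i≢l ∘ sym) (j≢l ∘ sym)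

hamming-togglePair≡0⇒SamePair : (e e′ : Pair n) (x : V n) →
  hamming (togglePair e x) (togglePair e′ x) ≡ 0 → SamePair e e′
hamming-togglePair≡0⇒SamePair e e′ x h with pair-trichotomy e e′
... | inj₁ same = same
... | inj₂ (inj₁ adj) with () ← sym (hamming-togglePair-adjacent e e′ x adj) ⟨ trans ⟩ h
... | inj₂ (inj₂ dis) with () ← sym (hamming-togglePair-disjoint e e′ x dis) ⟨ trans ⟩ h

hamming-togglePair≡2⇔TAdj : (e e′ : Pair n) (x : V n) →
  hamming (togglePair e x) (togglePair e′ x) ≡ 2 ⇔ TAdj e e′
hamming-togglePair≡2⇔TAdj e e′ x = mk⇔ to (hamming-togglePair-adjacent e e′ x)
  where
  to : hamming (togglePair e x) (togglePair e′ x) ≡ 2 → TAdj e e′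
  to h with pair-trichotomy e e′
  ... | inj₁ same with () ← sym (hamming-togglePair-same e e′ x same) ⟨ trans ⟩ h
  ... | inj₂ (inj₁ adj) = adj
  ... | inj₂ (inj₂ dis) with () ← sym (hamming-togglePair-disjoint e e′ x dis) ⟨ trans ⟩ h

act-isometry : (k : Aut n) (x y : V n) → hamming (act k x) (act k y) ≡ hamming x y
act-isometry (v , σ) x y = begin
  hamming (act (v , σ) x) (act (v , σ) y)            ≡⟨ hamming≡sum (act (v , σ) x) (act (v , σ) y) ⟩
  sum (λ i → differs (x (σ ⟨$⟩ʳ i) xor v i) (y (σ ⟨$⟩ʳ i) xor v i))
    ≡⟨ sum-cong-≗ (λ i → cong (if_then 1 else 0) (xor-cancel (x (σ ⟨$⟩ʳ i)) (y (σ ⟨$⟩ʳ i)) (v i))) ⟩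
  sum (λ i → differs (x (σ ⟨$⟩ʳ i)) (y (σ ⟨$⟩ʳ i)))  ≡⟨ sum-permute (λ i → differs (x i) (y i)) σ ⟨
  sum (λ i → differs (x i) (y i))                    ≡⟨ hamming≡sum x y ⟨
  hamming x y                                        ∎
  where
  open ≡-Reasoning
  xor-cancel : ∀ a b c → (a xor c) xor (b xor c) ≡ a xor b
  xor-cancel a     b     false = cong₂ _xor_ (xor-identityʳ a) (xor-identityʳ b)
  xor-cancel false false true = refl
  xor-cancel false true  true = refl
  xor-cancel true  false true = refl
  xor-cancel true  true  true = refl

act-cong : (k : Aut n) {x y : V n} → x ≐ y → act k x ≐ act k y
act-cong (v , σ) x≐y i = cong (_xor v i) (x≐y (σ ⟨$⟩ʳ i))

act-idA : (x : V n) → act idA x ≐ x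
act-idA x i = xor-identityʳ (x i)

act-≈idA : (k : Aut n) (x : V n) → k ≈A idA → act k x ≐ x
act-≈idA (v , σ) x (v≗0 , σ≗id) i = cong₂ _xor_ (cong x (σ≗id i)) (v≗0 i) ⟨ trans ⟩ xor-identityʳ (x i)

act-mul : (a b : Aut n) (x : V n) → act (mul a b) x ≐ act a (act b x)
act-mul (v , σ) (w , τ) x i = sym (xor-assoc (x (τ ⟨$⟩ʳ (σ ⟨$⟩ʳ i))) (w (σ ⟨$⟩ʳ i)) (v i))

act-inv : (a : Aut n) (x : V n) → act (inv a) (act a x) ≐ x
act-inv (v , σ) x j = xor-cancelʳ (x (σ ⟨$⟩ʳ (σ ⟨$⟩ˡ j))) (v (σ ⟨$⟩ˡ j)) ⟨ trans ⟩ cong x (inverseʳ σ)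
  where
  xor-cancelʳ : ∀ a b → (a xor b) xor b ≡ a
  xor-cancelʳ a b = xor-assoc a b b ⟨ trans ⟩ cong (a xor_) (xor-same b) ⟨ trans ⟩ xor-identityʳ a

-- Working coordinatewise avoids deciding whether k is trivial: a coordinate where
-- x and y differ witnesses that k is nontrivial.
sameOrbit-separated : {K : Aut n → Set} {m : ℕ} → dK≥ K (suc m) →
  {x y : V n} → SameOrbit K x y → hamming x y ≤ m → x ≐ y
sameOrbit-separated dk {x} {y} (k , k∈K , kx≐y) h i = decidable-stable (x i ≟ᵇ y i) λ xᵢ≢yᵢ →
  ≤⇒≯ h (≤-trans (dk k k∈K (k≉idA xᵢ≢yᵢ) x) (≤-reflexive (hamming-cong (λ _ → refl) kx≐y)))
  where
  k≉idA : x i ≢ y i → ¬ k ≈A idA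
  k≉idA xᵢ≢yᵢ k≈id = xᵢ≢yᵢ (sym (act-≈idA k x k≈id i) ⟨ trans ⟩ kx≐y i)

module _ {K : Aut n → Set} (K≤Aut : IsSubgroup K) where
  open IsSubgroup K≤Aut

  ≐⇒sameOrbit : {x y : V n} → x ≐ y → SameOrbit K x y
  ≐⇒sameOrbit {x} x≐y = idA , has-id , λ i → act-idA x i ⟨ trans ⟩ x≐y i

  sameOrbit-refl : (x : V n) → SameOrbit K x x
  sameOrbit-refl x = ≐⇒sameOrbit {x} λ _ → refl

  sameOrbit-sym : (x y : V n) → SameOrbit K x y → SameOrbit K y x
  sameOrbit-sym x y (k , k∈K , kx≐y) =
    inv k , inverse k∈K , λ i → sym (act-cong (inv k) {act k x} {y} kx≐y i) ⟨ trans ⟩ act-inv k x i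

  sameOrbit-trans : (x y z : V n) → SameOrbit K x y → SameOrbit K y z → SameOrbit K x z
  sameOrbit-trans x y z (a , a∈K , ax≐y) (b , b∈K , by≐z) =
    mul b a , closed b∈K a∈K ,
    λ i → act-mul b a x i ⟨ trans ⟩ act-cong b {act a x} {y} ax≐y i ⟨ trans ⟩ by≐z i

  sameOrbit-transport : (x x′ y y′ : V n) → SameOrbit K x x′ → SameOrbit K y y′ →
    Σ (V n) λ y″ → SameOrbit K y y″ × hamming x y″ ≡ hamming x′ y′
  sameOrbit-transport x x′ y y′ x~x′ y~y′ with sameOrbit-sym x x′ x~x′
  ... | c , c∈K , cx′≐x =
    act c y′ , sameOrbit-trans y y′ (act c y′) y~y′ (c , c∈K , λ _ → refl) ,
    (hamming-cong (λ i → sym (cx′≐x i)) (λ _ → refl) ⟨ trans ⟩ act-isometry c x′ y′)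

  Pi2Adj⇒representative : {x y : V n} → Pi2Adj K x y →
    Σ (V n) λ y′ → SameOrbit K y y′ × hamming x y′ ≡ 2
  Pi2Adj⇒representative {x} {y}
    (¬same-orbit , ¬adjacent , z , (_ , x₁ , z₁ , x~x₁ , z~z₁ , x₁z₁) , (_ , z₂ , y₂ , z~z₂ , y~y₂ , z₂y₂))
    with sameOrbit-transport x x₁ z z₁ x~x₁ z~z₁
  ... | z′ , z~z′ , xz′≡
    with sameOrbit-transport z′ z₂ y y₂ (sameOrbit-trans z′ z z₂ (sameOrbit-sym z z′ z~z′) z~z₂) y~y₂
  ... | y′ , y~y′ , z′y′≡ = y′ , y~y′ , distance≡2 (hamming x y′) refl
    where
    distance≤2 : hamming x y′ ≤ 2
    distance≤2 = hamming-triangle≡ x z′ y′ (xz′≡ ⟨ trans ⟩ x₁z₁) (z′y′≡ ⟨ trans ⟩ z₂y₂)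
    distance≡2 : ∀ d → hamming x y′ ≡ d → hamming x y′ ≡ 2
    distance≡2 0 h = contradiction
      (sameOrbit-trans x y′ y (≐⇒sameOrbit (hamming≡0⇒≐ x y′ h)) (sameOrbit-sym y y′ y~y′)) ¬same-orbit
    distance≡2 1 h = contradiction (¬same-orbit , x , y′ , sameOrbit-refl x , y~y′ , h) ¬adjacent
    distance≡2 2 h = h
    distance≡2 (suc (suc (suc d))) h with () ← ≤⇒≯ distance≤2 (subst (3 ≤_) (sym h) (s≤s (s≤s (s≤s z≤n))))

module SeparatedOrbits {K : Aut n → Set} (K≤Aut : IsSubgroup K) (dK≥7 : dK≥ K 7) where

  separated : {x y : V n} → SameOrbit K x y → hamming x y ≤ 6 → x ≐ y
  separated = sameOrbit-separated dK≥7

  hamming≡1⇒PiAdj : {x y : V n} → hamming x y ≡ 1 → PiAdj K x y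
  hamming≡1⇒PiAdj {x} {y} h = ¬same-orbit , x , y , sameOrbit-refl K≤Aut x , sameOrbit-refl K≤Aut y , h
    where
    ¬same-orbit : ¬ SameOrbit K x y
    ¬same-orbit x~y with () ← sym h ⟨ trans ⟩ ≐⇒hamming≡0 (separated x~y (≤-reflexive h ⟨ ≤-trans ⟩ s≤s z≤n))

  hamming≡2⇒Pi2Adj : {x y : V n} → hamming x y ≡ 2 → Pi2Adj K x y
  hamming≡2⇒Pi2Adj {x} {y} h with hamming≡2⇒togglePair x y h
  ... | ((i , j) , _) , y≐ = ¬same-orbit , ¬adjacent , toggle j x ,
    hamming≡1⇒PiAdj (hamming-toggle j x) ,
    hamming≡1⇒PiAdj (hamming-cong (λ _ → refl) y≐ ⟨ trans ⟩ hamming-toggle i (toggle j x))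
    where
    ¬same-orbit : ¬ SameOrbit K x y
    ¬same-orbit x~y with () ← sym h ⟨ trans ⟩ ≐⇒hamming≡0 (separated x~y (≤-reflexive h ⟨ ≤-trans ⟩ s≤s (s≤s z≤n)))
    ¬adjacent : ¬ PiAdj K x y
    ¬adjacent (_ , x′ , y′ , x~x′ , y~y′ , x′y′≡1) with sameOrbit-transport K≤Aut x x′ y y′ x~x′ y~y′
    ... | y″ , y~y″ , xy″≡ = contradiction (sym h ⟨ trans ⟩ hamming-cong (λ _ → refl) y≐y″ ⟨ trans ⟩ xy″≡1) λ ()
      where
      xy″≡1 : hamming x y″ ≡ 1
      xy″≡1 = xy″≡ ⟨ trans ⟩ x′y′≡1
      y≐y″ : y ≐ y″
      y≐y″ = separated y~y″
        (hamming-triangle≡ y x y″ (hamming-sym y x ⟨ trans ⟩ h) xy″≡1 ⟨ ≤-trans ⟩ s≤s (s≤s (s≤s z≤n)))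

  Pi2Adj⇔hamming≡2 : {x y : V n} → hamming x y ≤ 4 → Pi2Adj K x y ⇔ hamming x y ≡ 2
  Pi2Adj⇔hamming≡2 {x} {y} xy≤4 = mk⇔ to hamming≡2⇒Pi2Adj
    where
    to : Pi2Adj K x y → hamming x y ≡ 2
    to x~₂y with Pi2Adj⇒representative K≤Aut x~₂y
    ... | y′ , y~y′ , xy′≡2 = hamming-cong (λ _ → refl) (separated y~y′ yy′≤6) ⟨ trans ⟩ xy′≡2
      where
      yy′≤6 : hamming y y′ ≤ 6
      yy′≤6 = hamming-triangle y x y′ ⟨ ≤-trans ⟩
        +-mono-≤ (≤-reflexive (hamming-sym y x) ⟨ ≤-trans ⟩ xy≤4) (≤-reflexive xy′≡2)

lemma5p1 : (n : ℕ) → 2 ≤ n → (K : Aut n → Set) → IsSubgroup K →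
    dK≥ K 7 → ComponentsLocallyTn K
lemma5p1 n _ K K≤Aut dK≥7 x = f , x~₂f , f-injective , f-surjective , f-adjacency
  where
  open SeparatedOrbits K≤Aut dK≥7
  f : Pair n → V n
  f e = togglePair e x
  x~₂f : ∀ e → Pi2Adj K x (f e)
  x~₂f e = hamming≡2⇒Pi2Adj (hamming-togglePair e x)
  f-injective : ∀ e e′ → SameOrbit K (f e) (f e′) → SamePair e e′
  f-injective e e′ fe~fe′ = hamming-togglePair≡0⇒SamePair e e′ x
    (≐⇒hamming≡0 (separated fe~fe′ (hamming-togglePair≤4 e e′ x ⟨ ≤-trans ⟩ s≤s (s≤s (s≤s (s≤s z≤n))))))
  f-surjective : ∀ y → Pi2Adj K x y → Σ (Pair n) λ e → SameOrbit K (f e) y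
  f-surjective y x~₂y with Pi2Adj⇒representative K≤Aut x~₂y
  ... | y′ , y~y′ , xy′≡2 with hamming≡2⇒togglePair x y′ xy′≡2
  ... | e , y′≐fe = e , sameOrbit-trans K≤Aut (f e) y′ y
    (≐⇒sameOrbit K≤Aut (λ i → sym (y′≐fe i))) (sameOrbit-sym K≤Aut y y′ y~y′)
  f-adjacency : ∀ e e′ → Pi2Adj K (f e) (f e′) ⇔ TAdj e e′
  f-adjacency e e′ = hamming-togglePair≡2⇔TAdj e e′ x ⇔-∘ Pi2Adj⇔hamming≡2 (hamming-togglePair≤4 e e′ x)
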